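{- Let $n\ge2$ and $k$ be integers with $1\le k\le n-1$, and let $G$ be a simple connected graph on $n$ vertices with edge connectivity $\kappa'(G)\le k$. Then $\prod_1(G)\ge (n-1)^2$, with equality if and only if $G\cong S_n$, and $\prod_2(G)\ge 4^{n-2}$, with equality if and only if $G\cong P_n$.
   Context: $d(v)$ is the degree of $v$. $\prod_1(G)=\prod_{u\in V(G)} d(u)^2$ and $\prod_2(G)=\prod_{uv\in E(G)} d(u)d(v)$. $\kappa'(G)$ is the edge connectivity (largest $k$ such that $G$ has at least two vertices and no edge cut of size $k-1$). $S_n$ is the star and $P_n$ the path on $n$ vertices. -}

module Defs where

open import Data.Nat using (ℕ; zero; suc; _≡ᵇ_; _<ᵇ_; _<_)
open import Data.Bool using (Bool; true; false; _∧_; _∨_; not; _xor_; if_then_else_)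
open import Data.Bool.Properties using (∨-comm)
open import Data.Fin using (Fin; toℕ)
open import Data.List using (List; []; _∷_; [_]; concatMap; map; length; allFin; filter)
open import Data.Nat.ListAction using (sum; product)
open import Data.Product using (_×_; _,_; Σ; ∃; proj₁; proj₂)
open import Data.Fin.Permutation using (Permutation′; _⟨$⟩ʳ_)
open import Relation.Binary.PropositionalEquality using (_≡_; refl)
open import Relation.Nullary using (¬_)

record Graph (n : ℕ) : Set where
  field
    adj   : Fin n → Fin n → Bool
    sym   : ∀ u v → adj u v ≡ adj v u
    irrefl : ∀ u → adj u u ≡ false
open Graph public

deg : ∀ {n} → Graph n → Fin n → ℕ
deg {n} G u = sum (map (λ v → if adj G u v then 1 else 0) (allFin n))

edges : ∀ {n} → Graph n → List (Fin n × Fin n)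
edges {n} G = concatMap (λ u → concatMap (λ v →
  if adj G u v ∧ (toℕ u <ᵇ toℕ v) then [ (u , v) ] else []) (allFin n)) (allFin n)

Π₁ : ∀ {n} → Graph n → ℕ
Π₁ {n} G = product (map (λ u → deg G u Data.Nat.* deg G u) (allFin n))

Π₂ : ∀ {n} → Graph n → ℕ
Π₂ G = product (map (λ e → deg G (proj₁ e) Data.Nat.* deg G (proj₂ e)) (edges G))

data Reach {n} (G : Graph n) : Fin n → Fin n → Set where
  here : ∀ {u} → Reach G u u
  step : ∀ {u v w} → adj G u v ≡ true → Reach G v w → Reach G u w

Connected : ∀ {n} → Graph n → Set
Connected {n} G = ∀ (u v : Fin n) → Reach G u v

removeEdges : ∀ {n} → (G : Graph n) → (Fin n → Fin n → Bool) → Graph n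
removeEdges G F = record
  { adj = λ u v → adj G u v ∧ not (F u v ∨ F v u)
  ; sym = λ u v → p u v
  ; irrefl = λ u → q u }
  where
  p : ∀ u v → adj G u v ∧ not (F u v ∨ F v u) ≡ adj G v u ∧ not (F v u ∨ F u v)
  p u v rewrite sym G u v | ∨-comm (F u v) (F v u) = refl
  q : ∀ u → adj G u u ∧ not (F u u ∨ F u u) ≡ false
  q u rewrite irrefl G u = refl

cutSize : ∀ {n} → Graph n → (Fin n → Fin n → Bool) → ℕ
cutSize G F = sum (map (λ e → if F (proj₁ e) (proj₂ e) ∨ F (proj₂ e) (proj₁ e) then 1 else 0) (edges G))

IsEdgeCut : ∀ {n} → Graph n → (Fin n → Fin n → Bool) → Set
IsEdgeCut G F = ¬ Connected (removeEdges G F)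

IsEdgeConnectivity : ∀ {n} → Graph n → ℕ → Set
IsEdgeConnectivity {n} G κ =
  (2 Data.Nat.≤ n) ×
  (∀ F → cutSize G F < κ → ¬ IsEdgeCut G F) ×
  Σ (Fin n → Fin n → Bool) (λ F → cutSize G F ≡ κ × IsEdgeCut G F)

_≅_ : ∀ {n} → Graph n → Graph n → Set
_≅_ {n} G H = Σ (Permutation′ n) λ σ → ∀ u v → adj G u v ≡ adj H (σ ⟨$⟩ʳ u) (σ ⟨$⟩ʳ v)

-- star S_n: vertex 0 is adjacent to every other vertex, no other edges
isZero : ∀ {n} → Fin n → Bool
isZero u = toℕ u ≡ᵇ 0

private
  xor-comm : ∀ a b → a xor b ≡ b xor a
  xor-comm false false = refl
  xor-comm false true = refl
  xor-comm true false = refl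
  xor-comm true true = refl
  xor-self : ∀ a → a xor a ≡ false
  xor-self false = refl
  xor-self true = refl
  sucᵇ : ∀ m → (suc m ≡ᵇ m) ≡ false
  sucᵇ zero = refl
  sucᵇ (suc m) = sucᵇ m

star : ∀ n → Graph n
star n = record
  { adj = λ u v → isZero u xor isZero v
  ; sym = λ u v → xor-comm (isZero u) (isZero v)
  ; irrefl = λ u → xor-self (isZero u) }

path : ∀ n → Graph n
path n = record
  { adj = λ u v → (suc (toℕ u) ≡ᵇ toℕ v) ∨ (suc (toℕ v) ≡ᵇ toℕ u)
  ; sym = λ u v → ∨-comm (suc (toℕ u) ≡ᵇ toℕ v) (suc (toℕ v) ≡ᵇ toℕ u)
  ; irrefl = λ u → q u }
  where
  q : ∀ u → ((suc (toℕ u) ≡ᵇ toℕ u) ∨ (suc (toℕ u) ≡ᵇ toℕ u)) ≡ false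
  q u rewrite sucᵇ (toℕ u) = refl

module Submission where

-- Write every degree as d(u) = 1 + x(u); in a connected graph on n ≥ 2 vertices all degrees
-- are positive.  A breadth-first spanning tree (every vertex other than the root gets a parent,
-- adjacent to it and one level closer to the root) shows Σ d(u) ≥ 2(n-1), i.e. Σ x(u) ≥ n-2.
--   * Π₁(G) = (∏ d(u))² and ∏ (1 + x(u)) ≥ 1 + Σ x(u) ≥ n-1.  Equality forces Σ x = n-2 and at
--     most one positive x(u): one vertex of degree n-1, all others leaves, i.e. the star.
--   * Π₂(G) = ∏ d(u)^d(u), since every vertex contributes its degree once per incident edge, and
--     d^d ≥ 4^(d-1), so Π₂(G) ≥ 4^(Σ x) ≥ 4^(n-2).  Equality forces Σ d = 2(n-1), so every edge
--     is a tree edge, and all degrees ≤ 2.  Rooting the tree at a leaf, every vertex has at most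
--     one child, so the BFS level is a bijection onto {0,…,n-1} carrying G onto the path.

open import Defs hiding (sym)
open import Data.Nat using (ℕ; zero; suc; _+_; _*_; _∸_; _^_; _≤_; _<_; z≤n; s≤s; s≤s⁻¹; _≡ᵇ_; _<ᵇ_; >-nonZero)
open import Data.Nat.Properties hiding (_≟_)
open import Data.Nat.Properties using () renaming (_≟_ to _≟ℕ_)
open import Data.Nat.ListAction using (sum; product)
open import Data.Nat.ListAction.Properties using (product-++)
open import Data.Bool using (Bool; true; false; _∧_; _∨_; not; if_then_else_; _xor_; T)
open import Data.Bool.Properties using (∧-conicalˡ; ∧-conicalʳ; ∨-zeroʳ)
open import Data.Unit using (tt)
open import Data.Fin using (Fin; zero; suc; toℕ; fromℕ<; punchOut)
open import Data.Fin.Properties using (_≟_; toℕ<n; toℕ-injective; toℕ-fromℕ<; injective⇒≤; any?; punchOut-injective)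
open import Data.Fin.Permutation using (Permutation′; _⟨$⟩ʳ_; permutation; transpose)
import Data.Fin.Permutation.Components as PermComponents
open import Data.List using (List; []; _∷_; [_]; map; allFin; tabulate; concatMap)
open import Data.List.Properties using (map-tabulate; map-++; map-cong)
open import Data.Product using (Σ; _×_; _,_; proj₁; proj₂)
open import Data.Sum using (_⊎_; inj₁; inj₂)
open import Data.Empty using (⊥; ⊥-elim)
open import Relation.Nullary using (¬_; yes; no; Dec)
open import Relation.Nullary.Decidable using (⌊_⌋)
open import Relation.Binary.PropositionalEquality hiding ([_])
open import Relation.Binary.Definitions using (tri<; tri≈; tri>)
open import Function using (_∘_)
open import Function.Bundles using (_⇔_; mk⇔)
import Algebra.Properties.CommutativeMonoid.Sum as MonoidSum

module ΣProps = MonoidSum +-0-commutativeMonoid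
module ΠProps = MonoidSum *-1-commutativeMonoid

-- sumF f and prodF f: the sum and the product of the values of f : Fin n → ℕ.  They are
-- opaque so that unification treats them as rigid; the lemmas below are their interface.
opaque
  sumF : ∀ {n} → (Fin n → ℕ) → ℕ
  sumF = ΣProps.sum

  prodF : ∀ {n} → (Fin n → ℕ) → ℕ
  prodF = ΠProps.sum

χ : Bool → ℕ
χ b = if b then 1 else 0

χ≤1 : ∀ b → χ b ≤ 1
χ≤1 true = s≤s z≤n
χ≤1 false = z≤n

opaque
  unfolding sumF prodF

  sum-allFin : ∀ {n} (f : Fin n → ℕ) → sum (map f (allFin n)) ≡ sumF f
  sum-allFin {n} f = trans (cong sum (map-tabulate (λ i → i) f)) (sum-tabulate f)
    where
    sum-tabulate : ∀ {m} (g : Fin m → ℕ) → sum (tabulate g) ≡ sumF g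
    sum-tabulate {zero} g = refl
    sum-tabulate {suc m} g = cong (g zero +_) (sum-tabulate (g ∘ suc))

  product-allFin : ∀ {n} (f : Fin n → ℕ) → product (map f (allFin n)) ≡ prodF f
  product-allFin {n} f = trans (cong product (map-tabulate (λ i → i) f)) (product-tabulate f)
    where
    product-tabulate : ∀ {m} (g : Fin m → ℕ) → product (tabulate g) ≡ prodF g
    product-tabulate {zero} g = refl
    product-tabulate {suc m} g = cong (g zero *_) (product-tabulate (g ∘ suc))

  sumF-cong : ∀ {n} {f g : Fin n → ℕ} → (∀ i → f i ≡ g i) → sumF f ≡ sumF g
  sumF-cong = ΣProps.sum-cong-≗

  prodF-cong : ∀ {n} {f g : Fin n → ℕ} → (∀ i → f i ≡ g i) → prodF f ≡ prodF g
  prodF-cong = ΠProps.sum-cong-≗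

  sumF-mono : ∀ {n} {f g : Fin n → ℕ} → (∀ i → f i ≤ g i) → sumF f ≤ sumF g
  sumF-mono {zero} f≤g = z≤n
  sumF-mono {suc n} f≤g = +-mono-≤ (f≤g zero) (sumF-mono (f≤g ∘ suc))

  prodF-mono : ∀ {n} {f g : Fin n → ℕ} → (∀ i → f i ≤ g i) → prodF f ≤ prodF g
  prodF-mono {zero} f≤g = ≤-refl
  prodF-mono {suc n} f≤g = *-mono-≤ (f≤g zero) (prodF-mono (f≤g ∘ suc))

  sumF-tight : ∀ {n} {f g : Fin n → ℕ} → (∀ i → f i ≤ g i) → sumF g ≤ sumF f → ∀ i → f i ≡ g i
  sumF-tight {suc n} {f} {g} f≤g Σg≤Σf zero with m≤n⇒m<n∨m≡n (f≤g zero)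
  ... | inj₂ eq = eq
  ... | inj₁ lt = ⊥-elim (<⇒≱ (+-mono-<-≤ lt (sumF-mono (f≤g ∘ suc))) Σg≤Σf)
  sumF-tight {suc n} {f} {g} f≤g Σg≤Σf (suc i) =
    sumF-tight (f≤g ∘ suc) (+-cancelˡ-≤ (f zero) _ _ (≤-trans (+-monoˡ-≤ _ (f≤g zero)) Σg≤Σf)) i

  sumF-term : ∀ {n} (f : Fin n → ℕ) a → f a ≤ sumF f
  sumF-term f zero = m≤m+n _ _
  sumF-term f (suc a) = ≤-trans (sumF-term (f ∘ suc) a) (m≤n+m _ _)

  sumF-two : ∀ {n} (f : Fin n → ℕ) a b → ¬ a ≡ b → f a + f b ≤ sumF f
  sumF-two f zero zero a≢b = ⊥-elim (a≢b refl)
  sumF-two f zero (suc b) a≢b = +-monoʳ-≤ (f zero) (sumF-term (f ∘ suc) b)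
  sumF-two f (suc a) zero a≢b =
    subst (_≤ sumF f) (+-comm (f zero) _) (+-monoʳ-≤ (f zero) (sumF-term (f ∘ suc) a))
  sumF-two f (suc a) (suc b) a≢b =
    ≤-trans (sumF-two (f ∘ suc) a b (a≢b ∘ cong suc)) (m≤n+m _ _)

  sumF-const : ∀ n c → sumF {n} (λ _ → c) ≡ n * c
  sumF-const zero c = refl
  sumF-const (suc n) c = cong (c +_) (sumF-const n c)

  prodF-const : ∀ n c → prodF {n} (λ _ → c) ≡ c ^ n
  prodF-const zero c = refl
  prodF-const (suc n) c = cong (c *_) (prodF-const n c)

  sumF-+ : ∀ {n} (f g : Fin n → ℕ) → sumF (λ i → f i + g i) ≡ sumF f + sumF g
  sumF-+ = ΣProps.∑-distrib-+

  prodF-* : ∀ {n} (f g : Fin n → ℕ) → prodF (λ i → f i * g i) ≡ prodF f * prodF g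
  prodF-* = ΠProps.∑-distrib-+

  sumF-comm : ∀ {m n} (f : Fin m → Fin n → ℕ) → sumF (λ i → sumF (f i)) ≡ sumF (λ j → sumF (λ i → f i j))
  sumF-comm = ΣProps.∑-comm

  prodF-comm : ∀ {m n} (f : Fin m → Fin n → ℕ) → prodF (λ i → prodF (f i)) ≡ prodF (λ j → prodF (λ i → f i j))
  prodF-comm = ΠProps.∑-comm

  sumF-permute : ∀ {n} (f : Fin n → ℕ) (σ : Permutation′ n) → sumF (λ u → f (σ ⟨$⟩ʳ u)) ≡ sumF f
  sumF-permute f σ = sym (ΣProps.sum-permute f σ)

  prodF-permute : ∀ {n} (f : Fin n → ℕ) (σ : Permutation′ n) → prodF (λ u → f (σ ⟨$⟩ʳ u)) ≡ prodF f
  prodF-permute f σ = sym (ΠProps.sum-permute f σ)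

  -- the defining equations, for use outside this block
  sumF-zero : (f : Fin 0 → ℕ) → sumF f ≡ 0
  sumF-zero f = refl

  prodF-zero : (f : Fin 0 → ℕ) → prodF f ≡ 1
  prodF-zero f = refl

  sumF-suc : ∀ {n} (f : Fin (suc n) → ℕ) → sumF f ≡ f zero + sumF (f ∘ suc)
  sumF-suc f = refl

  prodF-suc : ∀ {n} (f : Fin (suc n) → ℕ) → prodF f ≡ f zero * prodF (f ∘ suc)
  prodF-suc f = refl

  sumF-point : ∀ m (c : Fin (suc m)) a b → sumF (λ v → if ⌊ v ≟ c ⌋ then a else b) ≡ a + m * b
  sumF-point m zero a b = cong (a +_) (sumF-const m b)
  sumF-point (suc m) (suc c) a b = begin
      b + sumF (λ v → if ⌊ suc v ≟ suc c ⌋ then a else b)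
    ≡⟨ cong (b +_) (trans (sumF-cong drop-suc) (sumF-point m c a b)) ⟩
      b + (a + m * b)
    ≡⟨ trans (sym (+-assoc b a _)) (trans (cong (_+ m * b) (+-comm b a)) (+-assoc a b _)) ⟩
      a + (b + m * b) ∎
    where
    open ≡-Reasoning
    drop-suc : ∀ v → (if ⌊ suc v ≟ suc c ⌋ then a else b) ≡ (if ⌊ v ≟ c ⌋ then a else b)
    drop-suc v with v ≟ c
    ... | yes _ = refl
    ... | no _ = refl

sumF-indicator : ∀ m (c : Fin (suc m)) → sumF (λ v → χ ⌊ v ≟ c ⌋) ≡ 1
sumF-indicator m c = trans (sumF-point m c 1 0) (cong suc (*-zeroʳ m))

suc*suc : ∀ a b → suc a * suc b ≡ suc (a + b + a * b)
suc*suc a b = cong suc (trans (cong (b +_) (*-suc a b))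
  (trans (sym (+-assoc b a (a * b))) (cong (_+ a * b) (+-comm b a))))

opaque
  unfolding sumF prodF

  prod-suc-≥ : ∀ {n} (x : Fin n → ℕ) → suc (sumF x) ≤ prodF (λ i → suc (x i))
  prod-suc-≥ {zero} x = ≤-refl
  prod-suc-≥ {suc n} x = begin
    suc (x zero + sumF (x ∘ suc))                           ≤⟨ s≤s (m≤m+n _ _) ⟩
    suc (x zero + sumF (x ∘ suc) + x zero * sumF (x ∘ suc)) ≡⟨ sym (suc*suc (x zero) (sumF (x ∘ suc))) ⟩
    suc (x zero) * suc (sumF (x ∘ suc))                     ≤⟨ *-monoʳ-≤ (suc (x zero)) (prod-suc-≥ (x ∘ suc)) ⟩
    suc (x zero) * prodF (λ i → suc (x (suc i)))            ∎
    where open ≤-Reasoning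

  prod-suc-> : ∀ {n} (x : Fin n → ℕ) a b → ¬ a ≡ b → 1 ≤ x a → 1 ≤ x b →
    suc (suc (sumF x)) ≤ prodF (λ i → suc (x i))
  prod-suc-> x zero zero a≢b _ _ = ⊥-elim (a≢b refl)
  prod-suc-> x zero (suc b) a≢b xa≥1 xb≥1 = begin
    suc (suc (x zero + S))             ≡⟨ cong suc (sym (+-suc (x zero) S)) ⟩
    suc (x zero + suc S)               ≤⟨ s≤s (+-monoʳ-≤ (x zero) (+-monoˡ-≤ S (*-mono-≤ xa≥1 S≥1))) ⟩
    suc (x zero + (x zero * S + S))    ≡⟨ cong suc (trans (cong (x zero +_) (+-comm (x zero * S) S))
                                                          (sym (+-assoc (x zero) S _))) ⟩
    suc (x zero + S + x zero * S)      ≡⟨ sym (suc*suc (x zero) S) ⟩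
    suc (x zero) * suc S               ≤⟨ *-monoʳ-≤ (suc (x zero)) (prod-suc-≥ (x ∘ suc)) ⟩
    prodF (λ i → suc (x i))            ∎
    where
    open ≤-Reasoning
    S : ℕ
    S = sumF (x ∘ suc)
    S≥1 : 1 ≤ S
    S≥1 = ≤-trans xb≥1 (sumF-term (x ∘ suc) b)
  prod-suc-> x (suc a) zero a≢b xa≥1 xb≥1 = prod-suc-> x zero (suc a) (a≢b ∘ sym) xb≥1 xa≥1
  prod-suc-> x (suc a) (suc b) a≢b xa≥1 xb≥1 = begin
    suc (suc (x zero + S))             ≡⟨ cong suc (trans (sym (+-suc (x zero) S)) (+-comm (x zero) (suc S))) ⟩
    suc (suc S) + x zero               ≤⟨ +-mono-≤ IH (≤-trans (≤-reflexive (sym (*-identityʳ (x zero))))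
                                                               (*-monoʳ-≤ (x zero) P≥1)) ⟩
    P + x zero * P                     ∎
    where
    open ≤-Reasoning
    S : ℕ
    S = sumF (x ∘ suc)
    P : ℕ
    P = prodF (λ i → suc (x (suc i)))
    IH : suc (suc S) ≤ P
    IH = prod-suc-> (x ∘ suc) a b (a≢b ∘ cong suc) xa≥1 xb≥1
    P≥1 : 1 ≤ P
    P≥1 = ≤-trans (s≤s z≤n) IH

  prodF-pow : ∀ {n} c (x : Fin n → ℕ) → prodF (λ i → c ^ x i) ≡ c ^ sumF x
  prodF-pow {zero} c x = refl
  prodF-pow {suc n} c x =
    trans (cong (c ^ x zero *_) (prodF-pow c (x ∘ suc))) (sym (^-distribˡ-+-* c (x zero) _))

  prodF-pos : ∀ {n} (f : Fin n → ℕ) → (∀ i → 1 ≤ f i) → 1 ≤ prodF f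
  prodF-pos {zero} f f≥1 = ≤-refl
  prodF-pos {suc n} f f≥1 = *-mono-≤ (f≥1 zero) (prodF-pos (f ∘ suc) (f≥1 ∘ suc))

  prodF-strict : ∀ {n} (f g : Fin n → ℕ) → (∀ i → 1 ≤ f i) → (∀ i → f i ≤ g i) →
    ∀ a → f a < g a → prodF f < prodF g
  prodF-strict f g f≥1 f≤g zero lt = <-≤-trans
    (*-monoˡ-< (prodF (f ∘ suc)) {{>-nonZero (prodF-pos (f ∘ suc) (f≥1 ∘ suc))}} lt)
    (*-monoʳ-≤ (g zero) (prodF-mono (f≤g ∘ suc)))
  prodF-strict f g f≥1 f≤g (suc a) lt = <-≤-trans
    (*-monoʳ-< (f zero) {{>-nonZero (f≥1 zero)}} (prodF-strict (f ∘ suc) (g ∘ suc) (f≥1 ∘ suc) (f≤g ∘ suc) a lt))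
    (*-monoˡ-≤ _ (f≤g zero))

-- selfPower x = (1 + x)^(1 + x), the contribution d^d of a vertex of degree d = 1 + x to Π₂.
selfPower : ℕ → ℕ
selfPower x = suc x ^ suc x

selfPower-> : ∀ x → 2 ≤ x → 4 ^ x < selfPower x
selfPower-> (suc zero) (s≤s ())
selfPower-> (suc (suc zero)) _ = s≤s (m≤m+n 16 10)
selfPower-> x@(suc (suc (suc y))) _ =
  <-≤-trans (^-monoʳ-< 4 (s≤s (s≤s z≤n)) (n<1+n x)) (^-monoˡ-≤ (suc x) (s≤s (s≤s (s≤s (s≤s z≤n)))))

selfPower-≡ : ∀ x → x ≤ 1 → selfPower x ≡ 4 ^ x
selfPower-≡ zero _ = refl
selfPower-≡ (suc zero) _ = refl
selfPower-≡ (suc (suc _)) (s≤s ())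

selfPower-≥ : ∀ x → 4 ^ x ≤ selfPower x
selfPower-≥ x with 2 ≤? x
... | yes x≥2 = <⇒≤ (selfPower-> x x≥2)
... | no x≱2 = ≤-reflexive (sym (selfPower-≡ x (s≤s⁻¹ (≰⇒> x≱2))))

square-injective : ∀ a b → a * a ≡ b * b → a ≡ b
square-injective a b e with <-cmp a b
... | tri≈ _ a≡b _ = a≡b
... | tri< a<b _ _ = ⊥-elim (<-irrefl e (*-mono-< a<b a<b))
... | tri> _ _ a>b = ⊥-elim (<-irrefl (sym e) (*-mono-< a>b a>b))

deg-sum : ∀ {n} (G : Graph n) u → deg G u ≡ sumF (λ v → χ (adj G u v))
deg-sum G u = sum-allFin _

deg-iso : ∀ {n} (G H : Graph n) (σ : Permutation′ n) →
  (∀ u v → adj G u v ≡ adj H (σ ⟨$⟩ʳ u) (σ ⟨$⟩ʳ v)) → ∀ u → deg G u ≡ deg H (σ ⟨$⟩ʳ u)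
deg-iso G H σ σ-hom u = begin
  deg G u                                      ≡⟨ deg-sum G u ⟩
  sumF (λ v → χ (adj G u v))                   ≡⟨ sumF-cong (λ v → cong χ (σ-hom u v)) ⟩
  sumF (λ v → χ (adj H (σ ⟨$⟩ʳ u) (σ ⟨$⟩ʳ v))) ≡⟨ sumF-permute (λ w → χ (adj H (σ ⟨$⟩ʳ u) w)) σ ⟩
  sumF (λ w → χ (adj H (σ ⟨$⟩ʳ u) w))          ≡⟨ sym (deg-sum H _) ⟩
  deg H (σ ⟨$⟩ʳ u)                             ∎
  where open ≡-Reasoning

walk-first-edge : ∀ {n} {G : Graph n} {u v} → Reach G u v → ¬ u ≡ v → Σ (Fin n) (λ w → adj G u w ≡ true)
walk-first-edge here u≢u = ⊥-elim (u≢u refl)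
walk-first-edge (step u~w _) _ = _ , u~w

another-vertex : ∀ {m} (u : Fin (suc (suc m))) → Σ (Fin (suc (suc m))) (λ v → ¬ u ≡ v)
another-vertex zero = suc zero , λ ()
another-vertex (suc u) = zero , λ ()

deg-positive : ∀ {m} (G : Graph (suc (suc m))) → Connected G → ∀ u → 1 ≤ deg G u
deg-positive G conn u with another-vertex u
... | v , u≢v with walk-first-edge (conn u v) u≢v
... | w , u~w = subst (1 ≤_) (sym (deg-sum G u))
  (subst (_≤ sumF (λ v → χ (adj G u v))) (cong χ u~w) (sumF-term (λ v → χ (adj G u v)) w))

Π₁-square : ∀ {n} (G : Graph n) → Π₁ G ≡ prodF (deg G) * prodF (deg G)
Π₁-square G = trans (product-allFin _) (prodF-* (deg G) (deg G))

ifPos : Bool → ℕ → ℕ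
ifPos b y = if b then y else 1

product-concatMap : ∀ {A B : Set} (g : B → ℕ) (h : A → List B) (xs : List A) →
  product (map g (concatMap h xs)) ≡ product (map (λ x → product (map g (h x))) xs)
product-concatMap g h [] = refl
product-concatMap g h (x ∷ xs) =
  trans (cong product (map-++ g (h x) (concatMap h xs)))
    (trans (product-++ (map g (h x)) (map g (concatMap h xs)))
      (cong (product (map g (h x)) *_) (product-concatMap g h xs)))

product-singleton-if : ∀ {B : Set} (g : B → ℕ) b (e : B) → product (map g (if b then [ e ] else [])) ≡ ifPos b (g e)
product-singleton-if g true e = *-identityʳ (g e)
product-singleton-if g false e = refl

ifPos-* : ∀ b x y → ifPos b (x * y) ≡ ifPos b x * ifPos b y
ifPos-* true x y = refl
ifPos-* false x y = refl

ifPos-order : ∀ i j y → ¬ i ≡ j → ifPos (i <ᵇ j) y * ifPos (j <ᵇ i) y ≡ y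
ifPos-order zero zero y i≢j = ⊥-elim (i≢j refl)
ifPos-order zero (suc j) y i≢j = *-identityʳ y
ifPos-order (suc i) zero y i≢j = +-identityʳ y
ifPos-order (suc i) (suc j) y i≢j = ifPos-order i j y (i≢j ∘ cong suc)

ifPos-power : ∀ {n} (b : Fin n → Bool) y → prodF (λ v → ifPos (b v) y) ≡ y ^ sumF (λ v → χ (b v))
ifPos-power {zero} b y = trans (prodF-zero _) (cong (y ^_) (sym (sumF-zero _)))
ifPos-power {suc n} b y rewrite prodF-suc (λ v → ifPos (b v) y) | sumF-suc (λ v → χ (b v)) with b zero
... | true = cong (y *_) (ifPos-power (b ∘ suc) y)
... | false = trans (+-identityʳ _) (ifPos-power (b ∘ suc) y)

-- Π₂(G) = ∏_u d(u)^d(u): the edge uv contributes d(u) to the factor of u and d(v) to that of v.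
module _ {n} (G : Graph n) where
  private
    d : Fin n → ℕ
    d = deg G

    listed : Fin n → Fin n → Bool
    listed u v = adj G u v ∧ (toℕ u <ᵇ toℕ v)

    -- each edge at u is listed exactly once, as uv or as vu
    listed-once : ∀ u v → ifPos (listed u v) (d u) * ifPos (listed v u) (d u) ≡ ifPos (adj G u v) (d u)
    listed-once u v with adj G u v in u~v
    ... | false rewrite trans (Graph.sym G v u) u~v = refl
    ... | true rewrite trans (Graph.sym G v u) u~v = ifPos-order (toℕ u) (toℕ v) (d u) toℕu≢toℕv
      where
      toℕu≢toℕv : ¬ toℕ u ≡ toℕ v
      toℕu≢toℕv eq with toℕ-injective eq
      ... | refl with trans (sym u~v) (Graph.irrefl G u)
      ... | ()

    edgeWeight : Fin n × Fin n → ℕ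
    edgeWeight e = d (proj₁ e) * d (proj₂ e)

    F : (Fin n → Fin n → ℕ) → ℕ
    F h = prodF (λ u → prodF (h u))

    Π₂-double-product : Π₂ G ≡ F (λ u v → ifPos (listed u v) (d u * d v))
    Π₂-double-product = begin
      Π₂ G
        ≡⟨ product-concatMap edgeWeight _ (allFin n) ⟩
      product (map (λ u → product (map edgeWeight (pairsAt u))) (allFin n))
        ≡⟨ cong product (map-cong (λ u → trans (product-concatMap edgeWeight _ (allFin n))
              (trans (cong product (map-cong (λ v → product-singleton-if edgeWeight (listed u v) (u , v)) (allFin n)))
                 (product-allFin (λ v → ifPos (listed u v) (d u * d v))))) (allFin n)) ⟩
      product (map (λ u → prodF (λ v → ifPos (listed u v) (d u * d v))) (allFin n))
        ≡⟨ product-allFin _ ⟩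
      F (λ u v → ifPos (listed u v) (d u * d v)) ∎
      where
      open ≡-Reasoning
      pairsAt : Fin n → List (Fin n × Fin n)
      pairsAt u = concatMap (λ v → if listed u v then [ (u , v) ] else []) (allFin n)

  Π₂-vertex-form : Π₂ G ≡ prodF (λ u → d u ^ d u)
  Π₂-vertex-form = begin
    Π₂ G
      ≡⟨ Π₂-double-product ⟩
    F (λ u v → ifPos (listed u v) (d u * d v))
      ≡⟨ prodF-cong (λ u → trans (prodF-cong (λ v → ifPos-* (listed u v) (d u) (d v))) (prodF-* _ _)) ⟩
    prodF (λ u → prodF (λ v → ifPos (listed u v) (d u)) * prodF (λ v → ifPos (listed u v) (d v)))
      ≡⟨ prodF-* _ _ ⟩
    F (λ u v → ifPos (listed u v) (d u)) * F (λ u v → ifPos (listed u v) (d v))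
      ≡⟨ cong (F (λ u v → ifPos (listed u v) (d u)) *_) (prodF-comm (λ u v → ifPos (listed u v) (d v))) ⟩
    F (λ u v → ifPos (listed u v) (d u)) * F (λ u v → ifPos (listed v u) (d u))
      ≡⟨ sym (prodF-* _ _) ⟩
    prodF (λ u → prodF (λ v → ifPos (listed u v) (d u)) * prodF (λ v → ifPos (listed v u) (d u)))
      ≡⟨ prodF-cong (λ u → trans (sym (prodF-* _ _)) (prodF-cong (listed-once u))) ⟩
    F (λ u v → ifPos (adj G u v) (d u))
      ≡⟨ prodF-cong (λ u → trans (ifPos-power (adj G u) (d u)) (cong (d u ^_) (sym (deg-sum G u)))) ⟩
    prodF (λ u → d u ^ d u) ∎
    where open ≡-Reasoning

Π₁-iso : ∀ {n} (G H : Graph n) → G ≅ H → Π₁ G ≡ Π₁ H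
Π₁-iso G H (σ , σ-hom) = begin
  Π₁ G                                          ≡⟨ product-allFin _ ⟩
  prodF (λ u → deg G u * deg G u)               ≡⟨ prodF-cong (λ u → cong₂ _*_ (deg-iso G H σ σ-hom u) (deg-iso G H σ σ-hom u)) ⟩
  prodF (λ u → deg H (σ ⟨$⟩ʳ u) * deg H (σ ⟨$⟩ʳ u)) ≡⟨ prodF-permute (λ w → deg H w * deg H w) σ ⟩
  prodF (λ w → deg H w * deg H w)               ≡⟨ sym (product-allFin _) ⟩
  Π₁ H                                          ∎
  where open ≡-Reasoning

Π₂-iso : ∀ {n} (G H : Graph n) → G ≅ H → Π₂ G ≡ Π₂ H
Π₂-iso G H (σ , σ-hom) = begin
  Π₂ G                                            ≡⟨ Π₂-vertex-form G ⟩
  prodF (λ u → deg G u ^ deg G u)                 ≡⟨ prodF-cong (λ u → cong (λ t → t ^ t) (deg-iso G H σ σ-hom u)) ⟩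
  prodF (λ u → deg H (σ ⟨$⟩ʳ u) ^ deg H (σ ⟨$⟩ʳ u)) ≡⟨ prodF-permute (λ w → deg H w ^ deg H w) σ ⟩
  prodF (λ w → deg H w ^ deg H w)                 ≡⟨ sym (Π₂-vertex-form H) ⟩
  Π₂ H                                            ∎
  where open ≡-Reasoning

true≢false : ∀ {b} → b ≡ true → b ≡ false → ⊥
true≢false refl ()

∨-true : ∀ a b → a ∨ b ≡ true → a ≡ true ⊎ b ≡ true
∨-true true b _ = inj₁ refl
∨-true false b b≡true = inj₂ b≡true

anyF : ∀ {m} → (Fin m → Bool) → Bool
anyF {zero} f = false
anyF {suc m} f = f zero ∨ anyF (f ∘ suc)

anyF-intro : ∀ {m} (f : Fin m → Bool) a → f a ≡ true → anyF f ≡ true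
anyF-intro f zero fa rewrite fa = refl
anyF-intro f (suc a) fa with f zero
... | true = refl
... | false = anyF-intro (f ∘ suc) a fa

anyF-elim : ∀ {m} (f : Fin m → Bool) → anyF f ≡ true → Σ (Fin m) λ a → f a ≡ true
anyF-elim {suc m} f any with f zero in f0
... | true = zero , f0
... | false with anyF-elim (f ∘ suc) any
...   | a , fa = suc a , fa

least : (P : ℕ → Bool) (L : ℕ) → P L ≡ true → Σ ℕ (λ m → P m ≡ true × (∀ j → j < m → P j ≡ false))
least P L PL with P 0 in P0
... | true = 0 , P0 , λ j ()
least P zero PL | false = ⊥-elim (true≢false PL P0)
least P (suc L) PL | false with least (P ∘ suc) L PL
... | m , Pm , below = suc m , Pm , λ { zero _ → P0 ; (suc j) (s≤s j<m) → below j j<m }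

-- In a connected graph with root r, the level of a vertex is its distance from r; every vertex
-- v ≠ r has a parent: a neighbour one level closer to r.  The parent edges form a spanning tree.
module BreadthFirstTree {n} (G : Graph n) (conn : Connected G) (r : Fin n) where

  reached : ℕ → Fin n → Bool
  reached zero v = ⌊ v ≟ r ⌋
  reached (suc k) v = reached k v ∨ anyF (λ u → adj G v u ∧ reached k u)

  reached-neighbour : ∀ k v u → adj G v u ≡ true → reached k u ≡ true → reached (suc k) v ≡ true
  reached-neighbour k v u v~u rku with reached k v
  ... | true = refl
  ... | false = anyF-intro (λ u → adj G v u ∧ reached k u) u (subst (λ b → b ∧ reached k u ≡ true) (sym v~u) rku)

  reached-root : ∀ v → reached 0 v ≡ true → v ≡ r
  reached-root v r0 with v ≟ r
  ... | yes v≡r = v≡r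
  ... | no _ = ⊥-elim (true≢false r0 refl)

  root-reached : reached 0 r ≡ true
  root-reached with r ≟ r
  ... | yes _ = refl
  ... | no r≢r = ⊥-elim (r≢r refl)

  reached-by-walk : ∀ {v} → Reach G v r → Σ ℕ (λ L → reached L v ≡ true)
  reached-by-walk here = 0 , root-reached
  reached-by-walk {v} (step v~w walk) with reached-by-walk walk
  ... | L , rLw = suc L , reached-neighbour L v _ v~w rLw

  private
    firstReached : ∀ v → Σ ℕ (λ m → reached m v ≡ true × (∀ j → j < m → reached j v ≡ false))
    firstReached v = least (λ k → reached k v) (proj₁ (reached-by-walk (conn v r))) (proj₂ (reached-by-walk (conn v r)))

  level : Fin n → ℕ
  level v = proj₁ (firstReached v)

  level-reached : ∀ v → reached (level v) v ≡ true
  level-reached v = proj₁ (proj₂ (firstReached v))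

  level-≤ : ∀ v k → reached k v ≡ true → level v ≤ k
  level-≤ v k rk with level v ≤? k
  ... | yes ℓ≤k = ℓ≤k
  ... | no ℓ≰k = ⊥-elim (true≢false rk (proj₂ (proj₂ (firstReached v)) k (≰⇒> ℓ≰k)))

  level-root : level r ≡ 0
  level-root = n≤0⇒n≡0 (level-≤ r 0 root-reached)

  level-zero : ∀ v → level v ≡ 0 → v ≡ r
  level-zero v ℓ≡0 = reached-root v (subst (λ k → reached k v ≡ true) ℓ≡0 (level-reached v))

  not-root : ∀ v t → level v ≡ suc t → ¬ v ≡ r
  not-root v t ℓ≡suc refl = 0≢1+n (trans (sym level-root) ℓ≡suc)

  -- Neighbours differ in level by at most one, and a vertex other than the root has a neighbour
  -- one level lower.
  private
    parent-exists : ∀ v → ¬ v ≡ r → Σ (Fin n) λ u → adj G v u ≡ true × suc (level u) ≡ level v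
    parent-exists v v≢r with level v in ℓv | level-reached v
    ... | zero | _ = ⊥-elim (v≢r (level-zero v ℓv))
    ... | suc k | reached-sk with ∨-true (reached k v) _ reached-sk
    ...   | inj₁ reached-k = ⊥-elim (1+n≰n (subst (_≤ k) ℓv (level-≤ v k reached-k)))
    ...   | inj₂ some with anyF-elim (λ u → adj G v u ∧ reached k u) some
    ...     | u , v~u∧rku = u , v~u , cong suc (≤-antisym (level-≤ u k (∧-conicalʳ _ _ v~u∧rku)) k≤ℓu)
      where
      v~u : adj G v u ≡ true
      v~u = ∧-conicalˡ _ _ v~u∧rku
      k≤ℓu : k ≤ level u
      k≤ℓu = s≤s⁻¹ (subst (_≤ suc (level u)) ℓv
               (level-≤ v (suc (level u)) (reached-neighbour (level u) v u v~u (level-reached u))))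

  -- (the case split is on a given decision of v ≡ r, since v ≟ r also occurs inside level v)
  private
    parentBy : ∀ v → Dec (v ≡ r) → Fin n
    parentBy v (yes _) = r
    parentBy v (no v≢r) = proj₁ (parent-exists v v≢r)

    parentBy-spec : ∀ v (d : Dec (v ≡ r)) → ¬ v ≡ r →
      adj G v (parentBy v d) ≡ true × suc (level (parentBy v d)) ≡ level v
    parentBy-spec v (yes v≡r) v≢r = ⊥-elim (v≢r v≡r)
    parentBy-spec v (no v≢r) _ = proj₂ (parent-exists v v≢r)

  parent : Fin n → Fin n
  parent v = parentBy v (v ≟ r)

  parent-adj : ∀ v → ¬ v ≡ r → adj G v (parent v) ≡ true
  parent-adj v v≢r = proj₁ (parentBy-spec v (v ≟ r) v≢r)

  parent-level : ∀ v → ¬ v ≡ r → suc (level (parent v)) ≡ level v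
  parent-level v v≢r = proj₂ (parentBy-spec v (v ≟ r) v≢r)

  treeEdge : Fin n → Fin n → Bool
  treeEdge v u = not ⌊ v ≟ r ⌋ ∧ ⌊ u ≟ parent v ⌋

  treeEdge-intro : ∀ v → ¬ v ≡ r → treeEdge v (parent v) ≡ true
  treeEdge-intro v v≢r with v ≟ r | parent v ≟ parent v
  ... | yes v≡r | _ = ⊥-elim (v≢r v≡r)
  ... | no _ | yes _ = refl
  ... | no _ | no p≢p = ⊥-elim (p≢p refl)

  treeEdge-elim : ∀ v u → treeEdge v u ≡ true → ¬ v ≡ r × u ≡ parent v
  treeEdge-elim v u e with v ≟ r | u ≟ parent v
  ... | no v≢r | yes u≡pv = v≢r , u≡pv
  ... | yes _ | _ = ⊥-elim (true≢false e refl)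
  ... | no _ | no _ = ⊥-elim (true≢false e refl)

  -- Every tree edge is an edge, and is a tree edge in one direction only (levels strictly drop).
  treeEdge-≤-adj : ∀ v u → χ (treeEdge v u) + χ (treeEdge u v) ≤ χ (adj G v u)
  treeEdge-≤-adj v u with treeEdge v u in vu | treeEdge u v in uv
  ... | false | false = z≤n
  ... | true | false with treeEdge-elim v u vu
  ...   | v≢r , refl rewrite parent-adj v v≢r = ≤-refl
  treeEdge-≤-adj v u | false | true with treeEdge-elim u v uv
  ...   | u≢r , refl rewrite Graph.sym G (parent u) u | parent-adj u u≢r = ≤-refl
  treeEdge-≤-adj v u | true | true with treeEdge-elim v u vu | treeEdge-elim u v uv
  ...   | v≢r , u≡pv | u≢r , v≡pu = ⊥-elim (<-asym ℓv<ℓu ℓu<ℓv)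
    where
    ℓv<ℓu : level v < level u
    ℓv<ℓu = subst (λ w → level w < level u) (sym v≡pu) (≤-reflexive (parent-level u u≢r))
    ℓu<ℓv : level u < level v
    ℓu<ℓv = subst (λ w → level w < level v) (sym u≡pv) (≤-reflexive (parent-level v v≢r))

-- Handshake bound: a connected graph on m + 1 vertices has degree sum at least 2m, since each
-- of its m tree edges is counted at both ends.  If the bound is attained, every edge is a tree edge.
module DegreeSum {m} (G : Graph (suc m)) (conn : Connected G) (r : Fin (suc m)) where
  open BreadthFirstTree G conn r

  treeDeg : Fin (suc m) → ℕ
  treeDeg v = sumF (λ u → χ (treeEdge v u) + χ (treeEdge u v))

  private
    parents : ∀ v (d : Dec (v ≡ r)) → sumF (λ u → χ (not ⌊ d ⌋ ∧ ⌊ u ≟ parent v ⌋)) ≡ (if ⌊ d ⌋ then 0 else 1)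
    parents v (yes _) = trans (sumF-const (suc m) 0) (*-zeroʳ m)
    parents v (no _) = sumF-indicator m (parent v)

    treeEdge-count : sumF (λ v → sumF (λ u → χ (treeEdge v u))) ≡ m
    treeEdge-count = trans (sumF-cong (λ v → parents v (v ≟ r))) (trans (sumF-point m r 0 1) (*-identityʳ m))

    treeDeg-sum : sumF treeDeg ≡ m + m
    treeDeg-sum = begin
      sumF treeDeg
        ≡⟨ trans (sumF-cong (λ v → sumF-+ _ _)) (sumF-+ _ _) ⟩
      sumF (λ v → sumF (λ u → χ (treeEdge v u))) + sumF (λ v → sumF (λ u → χ (treeEdge u v)))
        ≡⟨ cong (sumF (λ v → sumF (λ u → χ (treeEdge v u))) +_) (sym (sumF-comm (λ u v → χ (treeEdge u v)))) ⟩
      sumF (λ v → sumF (λ u → χ (treeEdge v u))) + sumF (λ u → sumF (λ v → χ (treeEdge u v)))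
        ≡⟨ cong₂ _+_ treeEdge-count treeEdge-count ⟩
      m + m ∎
      where open ≡-Reasoning

    treeDeg-≤-deg : ∀ v → treeDeg v ≤ deg G v
    treeDeg-≤-deg v = subst (treeDeg v ≤_) (sym (deg-sum G v)) (sumF-mono (treeEdge-≤-adj v))

  degree-sum-≥ : m + m ≤ sumF (deg G)
  degree-sum-≥ = subst (_≤ sumF (deg G)) treeDeg-sum (sumF-mono treeDeg-≤-deg)

  degree-sum-tight : sumF (deg G) ≤ m + m → ∀ v u → χ (treeEdge v u) + χ (treeEdge u v) ≡ χ (adj G v u)
  degree-sum-tight Σdeg≤ v u = sumF-tight (treeEdge-≤-adj v)
    (≤-reflexive (trans (sym (deg-sum G v)) (sym (sumF-tight treeDeg-≤-deg (subst (sumF (deg G) ≤_) (sym treeDeg-sum) Σdeg≤) v))))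
    u

χ≡1 : ∀ b → χ b ≡ 1 → b ≡ true
χ≡1 true _ = refl

χ≡0 : ∀ b → χ b ≡ 0 → b ≡ false
χ≡0 false _ = refl

isZero-transpose : ∀ {n} (c u : Fin (suc n)) → isZero (PermComponents.transpose zero c u) ≡ ⌊ u ≟ c ⌋
isZero-transpose zero zero = refl
isZero-transpose zero (suc u) = refl
isZero-transpose (suc c) zero = refl
isZero-transpose (suc c) (suc u) with u ≟ c
... | yes _ = refl
... | no _ = refl

module StarRecognition {k} (G : Graph (suc (suc k))) (c : Fin (suc (suc k)))
  (deg-c : deg G c ≡ suc k) (deg-other : ∀ v → ¬ v ≡ c → deg G v ≡ 1) where

  private
    -- c is adjacent to every other vertex: its degree is as large as possible.
    centre-adj : ∀ v → ¬ v ≡ c → adj G c v ≡ true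
    centre-adj v v≢c = χ≡1 _ (trans (sumF-tight adj≤ Σ≤ v) (not-c (v ≟ c)))
      where
      adj≤ : ∀ v → χ (adj G c v) ≤ (if ⌊ v ≟ c ⌋ then 0 else 1)
      adj≤ v with v ≟ c
      ... | yes refl rewrite Graph.irrefl G c = z≤n
      ... | no _ = χ≤1 _
      Σ≤ : sumF (λ v → if ⌊ v ≟ c ⌋ then 0 else 1) ≤ sumF (λ v → χ (adj G c v))
      Σ≤ = ≤-reflexive (trans (sumF-point (suc k) c 0 1) (trans (*-identityʳ (suc k)) (trans (sym deg-c) (deg-sum G c))))
      not-c : (d : Dec (v ≡ c)) → (if ⌊ d ⌋ then 0 else 1) ≡ 1
      not-c (yes v≡c) = ⊥-elim (v≢c v≡c)
      not-c (no _) = refl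

    leaf-adj : ∀ u → ¬ u ≡ c → ∀ v → ¬ v ≡ c → adj G u v ≡ false
    leaf-adj u u≢c v v≢c = χ≡0 _ (trans (sym (sumF-tight c≤adj Σ≤ v)) (not-c (v ≟ c)))
      where
      c≤adj : ∀ v → χ ⌊ v ≟ c ⌋ ≤ χ (adj G u v)
      c≤adj v with v ≟ c
      ... | yes refl rewrite Graph.sym G u c | centre-adj u u≢c = ≤-refl
      ... | no _ = z≤n
      Σ≤ : sumF (λ v → χ (adj G u v)) ≤ sumF (λ v → χ ⌊ v ≟ c ⌋)
      Σ≤ = ≤-reflexive (trans (sym (deg-sum G u)) (trans (deg-other u u≢c) (sym (sumF-indicator (suc k) c))))
      not-c : (d : Dec (v ≡ c)) → χ ⌊ d ⌋ ≡ 0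
      not-c (yes v≡c) = ⊥-elim (v≢c v≡c)
      not-c (no _) = refl

    adj-star : ∀ u v → adj G u v ≡ (⌊ u ≟ c ⌋ xor ⌊ v ≟ c ⌋)
    adj-star u v with u ≟ c | v ≟ c
    ... | yes refl | yes refl = Graph.irrefl G c
    ... | yes refl | no v≢c = centre-adj v v≢c
    ... | no u≢c | yes refl = trans (Graph.sym G u c) (centre-adj u u≢c)
    ... | no u≢c | no v≢c = leaf-adj u u≢c v v≢c

  star-iso : G ≅ star (suc (suc k))
  star-iso = transpose zero c , λ u v →
    trans (adj-star u v) (sym (cong₂ _xor_ (isZero-transpose c u) (isZero-transpose c v)))

-- Π₁(S_{k+2}) = (k+1)²: the centre has degree k + 1 and the k + 1 leaves degree 1.
Π₁-star : ∀ k → Π₁ (star (suc (suc k))) ≡ suc k ^ 2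
Π₁-star k = begin
  Π₁ S                                   ≡⟨ product-allFin _ ⟩
  prodF (λ u → deg S u * deg S u)         ≡⟨ prodF-suc _ ⟩
  deg S zero * deg S zero * prodF (λ u → deg S (suc u) * deg S (suc u))
    ≡⟨ cong₂ _*_ (cong₂ _*_ deg-centre deg-centre) (trans (prodF-cong (λ u → cong₂ _*_ (deg-leaf u) (deg-leaf u)))
                                                      (trans (prodF-const (suc k) 1) (^-zeroˡ (suc k)))) ⟩
  suc k * suc k * 1                      ≡⟨ *-assoc (suc k) (suc k) 1 ⟩
  suc k ^ 2                              ∎
  where
  open ≡-Reasoning
  S : Graph (suc (suc k))
  S = star (suc (suc k))
  deg-centre : deg S zero ≡ suc k
  deg-centre = trans (deg-sum S zero) (trans (sumF-cong centre) (trans (sumF-point (suc k) zero 0 1) (*-identityʳ _)))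
    where
    centre : ∀ v → χ (adj S zero v) ≡ (if ⌊ v ≟ zero ⌋ then 0 else 1)
    centre zero = refl
    centre (suc v) = refl
  deg-leaf : ∀ u → deg S (suc u) ≡ 1
  deg-leaf u = trans (deg-sum S (suc u)) (trans (sumF-cong leaf) (sumF-indicator (suc k) zero))
    where
    leaf : ∀ v → χ (adj S (suc u) v) ≡ χ ⌊ v ≟ zero ⌋
    leaf zero = refl
    leaf (suc v) = refl

module Excess {n} (d : Fin n → ℕ) (d≥1 : ∀ u → 1 ≤ d u) where
  excess : Fin n → ℕ
  excess u = d u ∸ 1

  d≡1+excess : ∀ u → d u ≡ suc (excess u)
  d≡1+excess u = sym (trans (+-comm 1 (d u ∸ 1)) (m∸n+n≡m (d≥1 u)))

  sum-excess : sumF d ≡ n + sumF excess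
  sum-excess = trans (sumF-cong d≡1+excess)
    (trans (sumF-+ (λ _ → 1) excess) (cong (_+ sumF excess) (trans (sumF-const n 1) (*-identityʳ n))))

  selfPower-excess : prodF (λ u → d u ^ d u) ≡ prodF (λ u → selfPower (excess u))
  selfPower-excess = prodF-cong (λ u → cong (λ t → t ^ t) (d≡1+excess u))

selfPower-product-path : ∀ k (d : Fin (suc (suc k)) → ℕ) (d≥1 : ∀ u → 1 ≤ d u) → (∀ u → d u ≤ 2) →
  sumF d ≡ suc k + suc k → prodF (λ u → d u ^ d u) ≡ 4 ^ k
selfPower-product-path k d d≥1 d≤2 Σd = begin
  prodF (λ u → d u ^ d u)             ≡⟨ selfPower-excess ⟩
  prodF (λ u → selfPower (excess u))  ≡⟨ prodF-cong (λ u → selfPower-≡ (excess u) (∸-monoˡ-≤ 1 (d≤2 u))) ⟩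
  prodF (λ u → 4 ^ excess u)          ≡⟨ prodF-pow 4 excess ⟩
  4 ^ sumF excess                     ≡⟨ cong (4 ^_) Σexcess ⟩
  4 ^ k                               ∎
  where
  open ≡-Reasoning
  open Excess d d≥1
  Σexcess : sumF excess ≡ k
  Σexcess = +-cancelˡ-≡ (suc (suc k)) (sumF excess) k
    (trans (sym sum-excess) (trans Σd (+-suc (suc k) k)))

≡ᵇ-true : ∀ a b → (a ≡ᵇ b) ≡ true → a ≡ b
≡ᵇ-true a b e = ≡ᵇ⇒≡ a b (subst T (sym e) tt)

≡ᵇ-refl : ∀ a → (a ≡ᵇ a) ≡ true
≡ᵇ-refl zero = refl
≡ᵇ-refl (suc a) = ≡ᵇ-refl a

≡ᵇ-sym : ∀ a b → (a ≡ᵇ b) ≡ (b ≡ᵇ a)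
≡ᵇ-sym zero zero = refl
≡ᵇ-sym zero (suc b) = refl
≡ᵇ-sym (suc a) zero = refl
≡ᵇ-sym (suc a) (suc b) = ≡ᵇ-sym a b

count-toℕ : ∀ N i → sumF {N} (λ j → χ (i ≡ᵇ toℕ j)) ≡ χ (i <ᵇ N)
count-toℕ zero i = sumF-zero _
count-toℕ (suc N) zero = trans (sumF-suc _) (cong suc (trans (sumF-cong {N} {g = λ _ → 0} (λ j → refl))
                                                               (trans (sumF-const N 0) (*-zeroʳ N))))
count-toℕ (suc N) (suc i) = trans (sumF-suc _) (count-toℕ N i)

count-below : ∀ m → sumF {suc m} (λ u → χ (toℕ u <ᵇ m)) ≡ m
count-below zero = trans (sumF-suc _) (sumF-zero _)
count-below (suc m) = trans (sumF-suc _) (cong suc (count-below m))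

<ᵇ-true : ∀ {i N} → i < N → (i <ᵇ N) ≡ true
<ᵇ-true i<N = T⇒≡true (<⇒<ᵇ i<N)
  where
  T⇒≡true : ∀ {b} → T b → b ≡ true
  T⇒≡true {true} _ = refl

-- In P_{k+2} the vertex i has the successor i + 1 if i + 1 < k + 2 and the predecessor i - 1 if
-- i > 0; so every degree is 1 or 2 and the degree sum is 2(k+1).
module PathDegrees (k : ℕ) where
  private
    N : ℕ
    N = suc (suc k)

    P : Graph N
    P = path N

    successors predecessors : Fin N → ℕ
    successors u = sumF {N} (λ v → χ (suc (toℕ u) ≡ᵇ toℕ v))
    predecessors u = sumF {N} (λ v → χ (suc (toℕ v) ≡ᵇ toℕ u))

    -- the two ways of being adjacent exclude each other
    no-2-cycle : ∀ i → (suc (suc i) ≡ᵇ i) ≡ false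
    no-2-cycle zero = refl
    no-2-cycle (suc i) = no-2-cycle i

    χ-adj : ∀ u v → χ (adj P u v) ≡ χ (suc (toℕ u) ≡ᵇ toℕ v) + χ (suc (toℕ v) ≡ᵇ toℕ u)
    χ-adj u v with suc (toℕ u) ≡ᵇ toℕ v in succ
    ... | false = refl
    ... | true rewrite sym (≡ᵇ-true (suc (toℕ u)) (toℕ v) succ) | no-2-cycle (toℕ u) = refl

    deg-path : ∀ u → deg P u ≡ successors u + predecessors u
    deg-path u = trans (deg-sum P u) (trans (sumF-cong (χ-adj u)) (sumF-+ _ _))

    successors≡ : ∀ u → successors u ≡ χ (suc (toℕ u) <ᵇ N)
    successors≡ u = count-toℕ N (suc (toℕ u))

    predecessors≡ : ∀ u → predecessors u ≡ χ (0 <ᵇ toℕ u)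
    predecessors≡ u with toℕ u in u≡ | toℕ<n u
    ... | zero | _ = trans (sumF-cong {g = λ _ → 0} (λ v → refl)) (trans (sumF-const N 0) (*-zeroʳ N))
    ... | suc i | i<N = trans (sumF-cong (λ v → cong χ (≡ᵇ-sym (toℕ v) i)))
                          (trans (count-toℕ N i) (cong χ (<ᵇ-true (<-trans (n<1+n i) i<N))))

  deg-path≤2 : ∀ u → deg (path N) u ≤ 2
  deg-path≤2 u = subst (_≤ 2) (sym (deg-path u)) (+-mono-≤
    (subst (_≤ 1) (sym (successors≡ u)) (χ≤1 _)) (subst (_≤ 1) (sym (predecessors≡ u)) (χ≤1 _)))

  deg-path≥1 : ∀ u → 1 ≤ deg (path N) u
  deg-path≥1 u = subst (1 ≤_) (sym (deg-path u)) (has-neighbour (toℕ u) refl)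
    where
    has-neighbour : ∀ i → toℕ u ≡ i → 1 ≤ successors u + predecessors u
    has-neighbour zero u≡0 = ≤-trans (≤-reflexive (sym (trans (successors≡ u) (cong (λ t → χ (suc t <ᵇ N)) u≡0))))
                               (m≤m+n _ _)
    has-neighbour (suc i) u≡ = ≤-trans (≤-reflexive (sym (trans (predecessors≡ u) (cong (λ t → χ (0 <ᵇ t)) u≡))))
                                 (m≤n+m _ _)

  degree-sum-path : sumF (deg (path N)) ≡ suc k + suc k
  degree-sum-path = begin
    sumF (deg P)                                  ≡⟨ trans (sumF-cong deg-path) (sumF-+ _ _) ⟩
    sumF successors + sumF predecessors           ≡⟨ cong (sumF successors +_) (sumF-comm (λ u v → χ (suc (toℕ v) ≡ᵇ toℕ u))) ⟩
    sumF successors + sumF successors             ≡⟨ cong₂ _+_ Σsuccessors Σsuccessors ⟩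
    suc k + suc k                                 ∎
    where
    open ≡-Reasoning
    Σsuccessors : sumF successors ≡ suc k
    Σsuccessors = trans (sumF-cong successors≡) (count-below (suc k))

Π₂-path : ∀ k → Π₂ (path (suc (suc k))) ≡ 4 ^ k
Π₂-path k = trans (Π₂-vertex-form (path (suc (suc k))))
  (selfPower-product-path k (deg (path _)) deg-path≥1 deg-path≤2 degree-sum-path)
  where open PathDegrees k

-- An injective map Fin n → Fin n hits every value: otherwise it would inject Fin n into Fin (n - 1).
injective⇒surjective : ∀ {n} (f : Fin n → Fin n) → (∀ {u v} → f u ≡ f v → u ≡ v) → ∀ t → Σ (Fin n) (λ u → f u ≡ t)
injective⇒surjective {suc m} f f-inj t with any? (λ u → f u ≟ t)
... | yes found = found
... | no missed = ⊥-elim (1+n≰n (injective⇒≤ {f = squeeze} squeeze-inj))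
  where
  t≢f : ∀ u → ¬ t ≡ f u
  t≢f u t≡fu = missed (u , sym t≡fu)
  squeeze : Fin (suc m) → Fin m
  squeeze u = punchOut (t≢f u)
  squeeze-inj : ∀ {u v} → squeeze u ≡ squeeze v → u ≡ v
  squeeze-inj e = f-inj (punchOut-injective (t≢f _) (t≢f _) e)

injective⇒permutation : ∀ {n} (f : Fin n → Fin n) → (∀ {u v} → f u ≡ f v → u ≡ v) →
  Σ (Permutation′ n) (λ σ → ∀ u → σ ⟨$⟩ʳ u ≡ f u)
injective⇒permutation {n} f f-inj = permutation f (λ t → proj₁ (hit t)) (λ t → proj₂ (hit t))
  (λ u → f-inj (proj₂ (hit (f u)))) , λ u → refl
  where
  hit : ∀ t → Σ (Fin n) (λ u → f u ≡ t)
  hit = injective⇒surjective f f-inj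

bool-ext : ∀ {b c} → (b ≡ true → c ≡ true) → (c ≡ true → b ≡ true) → b ≡ c
bool-ext {true} {true} _ _ = refl
bool-ext {true} {false} b⇒c _ = sym (b⇒c refl)
bool-ext {false} {true} _ c⇒b = c⇒b refl
bool-ext {false} {false} _ _ = refl

χ-+≡1 : ∀ a b → χ a + χ b ≡ 1 → a ≡ true ⊎ b ≡ true
χ-+≡1 true b _ = inj₁ refl
χ-+≡1 false true _ = inj₂ refl

-- A connected graph on k + 2 vertices with degree sum 2(k+1) (a tree), all degrees ≤ 2, and a
-- vertex r of degree 1 is a path starting at r: in the BFS tree from r every vertex has at most
-- one child, so the level u ↦ dist(r, u) is a bijection onto {0, …, k+1} carrying G to P_{k+2}.
module PathRecognition {k} (G : Graph (suc (suc k))) (conn : Connected G) (r : Fin (suc (suc k)))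
  (deg-r : deg G r ≡ 1) (deg≤2 : ∀ v → deg G v ≤ 2) (Σdeg : sumF (deg G) ≤ suc k + suc k) where

  open BreadthFirstTree G conn r
  open DegreeSum G conn r

  private
    N : ℕ
    N = suc (suc k)

    every-edge-in-tree : ∀ v u → χ (treeEdge v u) + χ (treeEdge u v) ≡ χ (adj G v u)
    every-edge-in-tree = degree-sum-tight Σdeg

    deg-split : ∀ w → deg G w ≡ sumF (λ x → χ (treeEdge w x)) + sumF (λ x → χ (treeEdge x w))
    deg-split w = trans (deg-sum G w) (trans (sumF-cong (λ x → sym (every-edge-in-tree w x))) (sumF-+ _ _))

    χ-true : ∀ {b} → b ≡ true → χ b ≡ 1
    χ-true refl = refl

    -- No vertex has two children: the root would get degree 2, any other vertex degree 3.
    parent-injective : ∀ u v → ¬ u ≡ r → ¬ v ≡ r → parent u ≡ parent v → u ≡ v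
    parent-injective u v u≢r v≢r pu≡pv with u ≟ v
    ... | yes u≡v = u≡v
    ... | no u≢v = ⊥-elim (too-many-children (w ≟ r))
      where
      w : Fin N
      w = parent u
      children≥2 : 2 ≤ sumF (λ x → χ (treeEdge x w))
      children≥2 = subst (_≤ sumF (λ x → χ (treeEdge x w)))
        (cong₂ _+_ (χ-true (treeEdge-intro u u≢r)) (χ-true (subst (λ y → treeEdge v y ≡ true) (sym pu≡pv) (treeEdge-intro v v≢r))))
        (sumF-two (λ x → χ (treeEdge x w)) u v u≢v)
      too-many-children : Dec (w ≡ r) → ⊥
      too-many-children (yes w≡r) = 1+n≰n (subst (2 ≤_) (trans (sym (deg-split w)) (trans (cong (deg G) w≡r) deg-r))
                                                  (≤-trans children≥2 (m≤n+m _ _)))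
      too-many-children (no w≢r) = 1+n≰n (≤-trans (subst (3 ≤_) (sym (deg-split w)) (+-mono-≤ parents≥1 children≥2)) (deg≤2 w))
        where
        parents≥1 : 1 ≤ sumF (λ x → χ (treeEdge w x))
        parents≥1 = subst (_≤ sumF (λ x → χ (treeEdge w x))) (χ-true (treeEdge-intro w w≢r))
                      (sumF-term (λ x → χ (treeEdge w x)) (parent w))

    level-injective : ∀ t u v → level u ≡ t → level v ≡ t → u ≡ v
    level-injective zero u v ℓu≡0 ℓv≡0 = trans (level-zero u ℓu≡0) (sym (level-zero v ℓv≡0))
    level-injective (suc t) u v ℓu≡ ℓv≡ = parent-injective u v u≢r v≢r
      (level-injective t (parent u) (parent v) (suc-injective (trans (parent-level u u≢r) ℓu≡))
                                               (suc-injective (trans (parent-level v v≢r) ℓv≡)))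
      where
      u≢r : ¬ u ≡ r
      u≢r = not-root u t ℓu≡
      v≢r : ¬ v ≡ r
      v≢r = not-root v t ℓv≡

    ancestor : ∀ t u j → level u ≡ j + t → Σ (Fin N) (λ w → level w ≡ j)
    ancestor zero u j ℓu≡ = u , trans ℓu≡ (+-identityʳ j)
    ancestor (suc t) u j ℓu≡ = ancestor t (parent u) j (suc-injective (trans (parent-level u u≢r) ℓu≡'))
      where
      ℓu≡' : level u ≡ suc (j + t)
      ℓu≡' = trans ℓu≡ (+-suc j t)
      u≢r : ¬ u ≡ r
      u≢r = not-root u (j + t) ℓu≡'

    -- Levels 0, …, level u are all occupied, by distinct vertices, so level u < N.
    level<N : ∀ u → level u < N
    level<N u = injective⇒≤ {f = occupant} occupant-inj
      where
      occupant-spec : ∀ (j : Fin (suc (level u))) → Σ (Fin N) (λ w → level w ≡ toℕ j)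
      occupant-spec j = ancestor (level u ∸ toℕ j) u (toℕ j) (sym (m+[n∸m]≡n (s≤s⁻¹ (toℕ<n j))))
      occupant : Fin (suc (level u)) → Fin N
      occupant j = proj₁ (occupant-spec j)
      occupant-inj : ∀ {i j} → occupant i ≡ occupant j → i ≡ j
      occupant-inj {i} {j} e = toℕ-injective (trans (sym (proj₂ (occupant-spec i)))
                                                (trans (cong level e) (proj₂ (occupant-spec j))))

    -- the level as an element of Fin N (opaque: only position-level is used about it)
    opaque
      position : Fin N → Fin N
      position u = fromℕ< (level<N u)

      position-level : ∀ u → toℕ (position u) ≡ level u
      position-level u = toℕ-fromℕ< (level<N u)

    position-injective : ∀ {u v} → position u ≡ position v → u ≡ v
    position-injective {u} {v} e =
      level-injective (level v) u v (trans (sym (position-level u)) (trans (cong toℕ e) (position-level v))) refl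

    adj-levels : ∀ u v → adj G u v ≡ ((suc (level u) ≡ᵇ level v) ∨ (suc (level v) ≡ᵇ level u))
    adj-levels u v = bool-ext edge⇒levels levels⇒edge
      where
      edge⇒levels : adj G u v ≡ true → ((suc (level u) ≡ᵇ level v) ∨ (suc (level v) ≡ᵇ level u)) ≡ true
      edge⇒levels u~v with χ-+≡1 (treeEdge u v) (treeEdge v u) (trans (every-edge-in-tree u v) (χ-true u~v))
      ... | inj₁ uv with treeEdge-elim u v uv
      ...   | u≢r , refl rewrite sym (parent-level u u≢r) | ≡ᵇ-refl (suc (level v)) = ∨-zeroʳ _
      edge⇒levels u~v | inj₂ vu with treeEdge-elim v u vu
      ...   | v≢r , refl rewrite sym (parent-level v v≢r) | ≡ᵇ-refl (suc (level u)) = refl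
      levels⇒edge : ((suc (level u) ≡ᵇ level v) ∨ (suc (level v) ≡ᵇ level u)) ≡ true → adj G u v ≡ true
      levels⇒edge one-apart with ∨-true _ _ one-apart
      ... | inj₁ ℓv≡ = trans (Graph.sym G u v) (subst (λ z → adj G v z ≡ true) pv≡u (parent-adj v v≢r))
        where
        ℓv≡1+ℓu : level v ≡ suc (level u)
        ℓv≡1+ℓu = sym (≡ᵇ-true _ _ ℓv≡)
        v≢r : ¬ v ≡ r
        v≢r = not-root v (level u) ℓv≡1+ℓu
        pv≡u : parent v ≡ u
        pv≡u = level-injective (level u) (parent v) u (suc-injective (trans (parent-level v v≢r) ℓv≡1+ℓu)) refl
      ... | inj₂ ℓu≡ = subst (λ z → adj G u z ≡ true) pu≡v (parent-adj u u≢r)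
        where
        ℓu≡1+ℓv : level u ≡ suc (level v)
        ℓu≡1+ℓv = sym (≡ᵇ-true _ _ ℓu≡)
        u≢r : ¬ u ≡ r
        u≢r = not-root u (level v) ℓu≡1+ℓv
        pu≡v : parent u ≡ v
        pu≡v = level-injective (level v) (parent u) v (suc-injective (trans (parent-level u u≢r) ℓu≡1+ℓv)) refl

  path-iso : G ≅ path N
  path-iso with injective⇒permutation position position-injective
  ... | σ , σ≡position = σ , λ u v → trans (adj-levels u v)
    (sym (cong₂ (λ a b → (suc a ≡ᵇ b) ∨ (suc b ≡ᵇ a)) (trans (cong toℕ (σ≡position u)) (position-level u))
                                                      (trans (cong toℕ (σ≡position v)) (position-level v))))

concentrated : ∀ {m} (x : Fin (suc m) → ℕ) → (∀ a b → ¬ a ≡ b → 1 ≤ x a → 1 ≤ x b → ⊥) →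
  Σ (Fin (suc m)) (λ c → (∀ v → ¬ v ≡ c → x v ≡ 0) × x c ≡ sumF x)
concentrated {m} x at-most-one with any? (λ v → 1 ≤? x v)
... | yes (c , xc≥1) = c , zero-off-c , x-at-c
  where
  ≱1⇒0 : ∀ t → ¬ 1 ≤ t → t ≡ 0
  ≱1⇒0 zero _ = refl
  ≱1⇒0 (suc t) t≱1 = ⊥-elim (t≱1 (s≤s z≤n))
  zero-off-c : ∀ v → ¬ v ≡ c → x v ≡ 0
  zero-off-c v v≢c = ≱1⇒0 (x v) (λ xv≥1 → at-most-one v c v≢c xv≥1 xc≥1)
  on-c : ∀ v → (if ⌊ v ≟ c ⌋ then x c else 0) ≡ x v
  on-c v with v ≟ c
  ... | yes refl = refl
  ... | no v≢c = sym (zero-off-c v v≢c)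
  x-at-c : x c ≡ sumF x
  x-at-c = trans (sym (trans (sumF-point m c (x c) 0) (trans (cong (x c +_) (*-zeroʳ m)) (+-identityʳ _))))
                 (sumF-cong on-c)
... | no none = zero , (λ v _ → all-zero v) ,
                trans (all-zero zero) (sym (trans (sumF-cong all-zero) (trans (sumF-const (suc m) 0) (*-zeroʳ (suc m)))))
  where
  all-zero : ∀ v → x v ≡ 0
  all-zero v with x v in xv
  ... | zero = refl
  ... | suc _ = ⊥-elim (none (v , subst (1 ≤_) (sym xv) (s≤s z≤n)))

some-zero : ∀ {n} (x : Fin n → ℕ) → sumF x < n → Σ (Fin n) (λ v → x v ≡ 0)
some-zero {n} x Σx<n with any? (λ v → x v ≟ℕ 0)
... | yes found = found
... | no none = ⊥-elim (<⇒≱ Σx<n (subst (_≤ sumF x) (trans (sumF-const n 1) (*-identityʳ n)) (sumF-mono positive)))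
  where
  positive : ∀ v → 1 ≤ x v
  positive v with x v in xv
  ... | zero = ⊥-elim (none (v , xv))
  ... | suc _ = s≤s z≤n

module ConnectedGraphBounds {K} (G : Graph (suc (suc K))) (conn : Connected G) where
  open Excess (deg G) (deg-positive G conn)

  private
    N : ℕ
    N = suc (suc K)

  excess-sum-≥ : K ≤ sumF excess
  excess-sum-≥ = +-cancelˡ-≤ (suc (suc K)) K (sumF excess)
    (subst₂ _≤_ (+-suc (suc K) K) sum-excess (DegreeSum.degree-sum-≥ G conn zero))

  ∏deg-≥ : suc (sumF excess) ≤ prodF (deg G)
  ∏deg-≥ = subst (suc (sumF excess) ≤_) (sym (prodF-cong d≡1+excess)) (prod-suc-≥ excess)

  Π₁-≥ : suc K ^ 2 ≤ Π₁ G
  Π₁-≥ = subst₂ _≤_ (sym (square (suc K))) (sym (Π₁-square G)) (*-mono-≤ ∏d≥ ∏d≥)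
    where
    square : ∀ a → a ^ 2 ≡ a * a
    square a = cong (a *_) (*-identityʳ a)
    ∏d≥ : suc K ≤ prodF (deg G)
    ∏d≥ = ≤-trans (s≤s excess-sum-≥) ∏deg-≥

  -- Equality in Π₁ forces ∏ d = K + 1 = 1 + Σ x, so at most one excess is positive: a star.
  Π₁-tight⇒star : Π₁ G ≡ suc K ^ 2 → G ≅ star N
  Π₁-tight⇒star Π₁≡ = StarRecognition.star-iso G c deg-c deg-other
    where
    ∏d≡ : prodF (deg G) ≡ suc K
    ∏d≡ = square-injective _ _ (trans (sym (Π₁-square G)) (trans Π₁≡ (cong (suc K *_) (*-identityʳ (suc K)))))
    Σexcess≡K : sumF excess ≡ K
    Σexcess≡K = ≤-antisym (s≤s⁻¹ (subst (suc (sumF excess) ≤_) ∏d≡ ∏deg-≥)) excess-sum-≥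
    at-most-one-positive : ∀ a b → ¬ a ≡ b → 1 ≤ excess a → 1 ≤ excess b → ⊥
    at-most-one-positive a b a≢b xa≥1 xb≥1 = 1+n≰n (subst₂ _≤_ (cong suc (cong suc Σexcess≡K))
      (trans (sym (prodF-cong d≡1+excess)) ∏d≡) (prod-suc-> excess a b a≢b xa≥1 xb≥1))
    centre : Σ (Fin N) (λ c → (∀ v → ¬ v ≡ c → excess v ≡ 0) × excess c ≡ sumF excess)
    centre = concentrated excess at-most-one-positive
    c : Fin N
    c = proj₁ centre
    deg-c : deg G c ≡ suc K
    deg-c = trans (d≡1+excess c) (cong suc (trans (proj₂ (proj₂ centre)) Σexcess≡K))
    deg-other : ∀ v → ¬ v ≡ c → deg G v ≡ 1
    deg-other v v≢c = trans (d≡1+excess v) (cong suc (proj₁ (proj₂ centre) v v≢c))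

  star⇒Π₁-tight : G ≅ star N → Π₁ G ≡ suc K ^ 2
  star⇒Π₁-tight G≅S = trans (Π₁-iso G (star N) G≅S) (Π₁-star K)

  Π₂-excess : Π₂ G ≡ prodF (λ u → selfPower (excess u))
  Π₂-excess = trans (Π₂-vertex-form G) selfPower-excess

  Π₂-≥-4^Σexcess : 4 ^ sumF excess ≤ Π₂ G
  Π₂-≥-4^Σexcess = subst₂ _≤_ (prodF-pow 4 excess) (sym Π₂-excess) (prodF-mono (λ u → selfPower-≥ (excess u)))

  Π₂-≥ : 4 ^ K ≤ Π₂ G
  Π₂-≥ = ≤-trans (^-monoʳ-≤ 4 excess-sum-≥) Π₂-≥-4^Σexcess

  -- Equality in Π₂ forces Σ x = K (a tree) and all x ≤ 1 (degrees ≤ 2); some vertex is then a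
  -- leaf, and the tree is a path starting there.
  Π₂-tight⇒path : Π₂ G ≡ 4 ^ K → G ≅ path N
  Π₂-tight⇒path Π₂≡ = PathRecognition.path-iso G conn leaf deg-leaf deg≤2 Σdeg≤
    where
    -- a larger Σ x would give Π₂ ≥ 4^(Σ x) > 4^K
    Σexcess≡K : sumF excess ≡ K
    Σexcess≡K with K <? sumF excess
    ... | yes K<Σ = ⊥-elim (<⇒≱ (^-monoʳ-< 4 (s≤s (s≤s z≤n)) K<Σ) (subst (4 ^ sumF excess ≤_) Π₂≡ Π₂-≥-4^Σexcess))
    ... | no K≮Σ = ≤-antisym (≮⇒≥ K≮Σ) excess-sum-≥
    -- an excess ≥ 2 would make the factor selfPower strictly larger than 4^x
    excess≤1 : ∀ v → excess v ≤ 1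
    excess≤1 v with 2 ≤? excess v
    ... | no xv≱2 = s≤s⁻¹ (≰⇒> xv≱2)
    ... | yes xv≥2 = ⊥-elim (<⇒≱ Π₂>4^K (≤-reflexive Π₂≡))
      where
      Π₂>4^K : 4 ^ K < Π₂ G
      Π₂>4^K = subst₂ _<_ (trans (prodF-pow 4 excess) (cong (4 ^_) Σexcess≡K)) (sym Π₂-excess)
        (prodF-strict (λ u → 4 ^ excess u) (λ u → selfPower (excess u)) (λ u → ^-monoʳ-≤ 4 {0} {excess u} z≤n)
                      (λ u → selfPower-≥ (excess u)) v (selfPower-> (excess v) xv≥2))
    -- not every excess is positive, since Σ x = K < K + 2
    some-leaf : Σ (Fin N) (λ v → excess v ≡ 0)
    some-leaf = some-zero excess (subst (_< N) (sym Σexcess≡K) (n≤1+n (suc K)))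
    leaf : Fin N
    leaf = proj₁ some-leaf
    deg-leaf : deg G leaf ≡ 1
    deg-leaf = trans (d≡1+excess leaf) (cong suc (proj₂ some-leaf))
    deg≤2 : ∀ v → deg G v ≤ 2
    deg≤2 v = subst (_≤ 2) (sym (d≡1+excess v)) (s≤s (excess≤1 v))
    Σdeg≤ : sumF (deg G) ≤ suc K + suc K
    Σdeg≤ = ≤-reflexive (trans sum-excess (trans (cong (N +_) Σexcess≡K) (sym (cong suc (+-suc K K)))))

  path⇒Π₂-tight : G ≅ path N → Π₂ G ≡ 4 ^ K
  path⇒Π₂-tight G≅P = trans (Π₂-iso G (path N) G≅P) (Π₂-path K)

-- For n = K + 2 the bounds read (K+1)² and 4^K.
theorem3p4 : (n k : ℕ) → 2 ≤ n → 1 ≤ k → k ≤ n ∸ 1 →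
    (G : Graph n) → Connected G →
    (κ : ℕ) → IsEdgeConnectivity G κ → κ ≤ k →
      ((n ∸ 1) ^ 2 ≤ Π₁ G × (Π₁ G ≡ (n ∸ 1) ^ 2 ⇔ G ≅ star n)) ×
      (4 ^ (n ∸ 2) ≤ Π₂ G × (Π₂ G ≡ 4 ^ (n ∸ 2) ⇔ G ≅ path n))
theorem3p4 (suc (suc K)) _ (s≤s (s≤s z≤n)) _ _ G conn _ _ _ =
  (Π₁-≥ , mk⇔ Π₁-tight⇒star star⇒Π₁-tight) , (Π₂-≥ , mk⇔ Π₂-tight⇒path path⇒Π₂-tight)
  where open ConnectedGraphBounds G conn
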